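{- Let $G$ and $H$ be finite simple graphs, and let $i_G$ be the number of isolated vertices of $G$. Then $$\rho(G\circ H)=\rho(G)+i_G\rho(H)-i_G.$$
   Context: A packing of a graph $G$ is a set $P\subseteq V(G)$ with $N_G[u]\cap N_G[v]=\emptyset$ for distinct $u,v\in P$ (closed neighborhoods); $\rho(G)$ is the maximum size of a packing. The lexicographic product $G\circ H$ has vertex set $V(G)\times V(H)$, with $(g,h)$ adjacent to $(g',h')$ iff either $gg'\in E(G)$, or $g=g'$ and $hh'\in E(H)$. -}

module Defs where

open import Data.Nat using (ℕ; _≤_; _*_; _+_)
open import Data.Fin using (quotient; remainder)
import Data.Fin.Properties as F
import Relation.Binary.PropositionalEquality as ≡
open import Relation.Nullary.Decidable using (_⊎-dec_; _×-dec_)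
open import Data.Fin using (Fin)
open import Data.Fin.Subset using (Subset; _∈_; ∣_∣)
open import Data.Product using (_×_; _,_; Σ; ∃; proj₁; proj₂)
open import Data.Sum using (_⊎_; inj₁; inj₂)
open import Data.Empty using (⊥)
open import Relation.Nullary using (¬_; Dec)
open import Relation.Binary.PropositionalEquality using (_≡_)

record Graph (n : ℕ) : Set₁ where
  field
    Adj   : Fin n → Fin n → Set
    dec   : ∀ u v → Dec (Adj u v)
    sym   : ∀ {u v} → Adj u v → Adj v u
    irrefl : ∀ {u} → ¬ Adj u u
open Graph public

InClosedNbhd : ∀ {n} → Graph n → Fin n → Fin n → Set
InClosedNbhd G u w = (w ≡ u) ⊎ Adj G u w

IsPacking : ∀ {n} → Graph n → Subset n → Set
IsPacking G P = ∀ u v → u ∈ P → v ∈ P → ¬ (u ≡ v) →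
  ∀ w → ¬ (InClosedNbhd G u w × InClosedNbhd G v w)

PackingNumber : ∀ {n} → Graph n → ℕ → Set
PackingNumber G k =
  (Σ (Subset _) λ P → IsPacking G P × ∣ P ∣ ≡ k) ×
  (∀ P → IsPacking G P → ∣ P ∣ ≤ k)

Isolated : ∀ {n} → Graph n → Fin n → Set
Isolated G u = ∀ v → ¬ Adj G u v

IsolatedCount : ∀ {n} → Graph n → ℕ → Set
IsolatedCount G k = Σ (Subset _) λ I → (∀ u → (u ∈ I → Isolated G u) × (Isolated G u → u ∈ I)) × ∣ I ∣ ≡ k

-- lexicographic product G ∘ H on Fin (m * n); the vertex i ↔ (quotient i , remainder i) = (g , h)
-- (Data.Fin.remQuot is a bijection Fin (m * n) ≃ Fin m × Fin n)
lexAdj : ∀ {m n} → Graph m → Graph n → Fin (m * n) → Fin (m * n) → Set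
lexAdj {m} {n} G H i j =
  Adj G (quotient n i) (quotient n j) ⊎
  ((quotient {m} n i ≡ quotient n j) × Adj H (remainder {m} n i) (remainder {m} n j))

lex : ∀ {m n} → Graph m → Graph n → Graph (m * n)
lex {m} {n} G H = record
  { Adj = lexAdj G H
  ; dec = λ i j → dec G (quotient n i) (quotient n j) ⊎-dec
            (quotient {m} n i F.≟ quotient n j ×-dec dec H (remainder {m} n i) (remainder {m} n j))
  ; sym = λ { (inj₁ a) → inj₁ (sym G a) ; (inj₂ (e , a)) → inj₂ (≡.sym e , sym H a) }
  ; irrefl = λ { (inj₁ a) → irrefl G a ; (inj₂ (_ , a)) → irrefl H a }
  }

-- A subset X of V(G ∘ H) is determined by its fibres X_g = {h ∣ (g , h) ∈ X}.
-- Two points over a non-isolated vertex g share the neighbour (v , h) for any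
-- neighbour v of g, while over an isolated vertex the closed neighbourhoods in
-- G ∘ H are those of H. So X is a packing exactly when the vertices with nonempty
-- fibre lie in a packing of G, every fibre is a packing of H, and fibres over
-- non-isolated vertices have at most one point. As isolated vertices can be added
-- to any packing of G, this bounds |X| by ρ(H) per isolated vertex plus one per
-- remaining vertex of a packing of G; a maximum packing of H over each isolated
-- vertex and one point over each other vertex of a maximum packing of G attain it.

module Submission where

open import Defs hiding (sym)
open import Data.Nat using (ℕ; zero; suc; _+_; _*_; _≤_; z≤n; s≤s)
open import Data.Nat.Properties
  using (+-*-semiring; module ≤-Reasoning; ≤-trans; ≤-reflexive; ≤-antisym; +-mono-≤; +-monoˡ-≤;
         m≤m+n; +-comm; *-identityˡ)
open import Algebra.Properties.Semiring.Sum +-*-semiring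
  using (sum-syntax; ∑-distrib-+; *-distribʳ-sum)
open import Data.Bool using (Bool; true; if_then_else_)
open import Data.Fin using (Fin; zero; suc; combine; quotient; remainder; _≟_)
open import Data.Fin.Properties
  using (remQuot-combine; combine-remQuot; combine-injectiveˡ; combine-injectiveʳ; ¬∀⟶∃¬)
open import Data.Fin.Subset
  using (Subset; _∈_; _∉_; _⊆_; _∪_; ∣_∣; inside; outside; ⁅_⁆; Nonempty; Empty)
  renaming (⊥ to ∅)
open import Data.Fin.Subset.Properties
  using (_∈?_; nonempty?; Empty-unique; ∣⊥∣≡0; ∉⊥; x∈⁅x⁆; x∈⁅y⁆⇒x≡y; ∣⁅x⁆∣≡1; p⊆q⇒∣p∣≤∣q∣;
         p⊆p∪q; x∈p∪q⁺; x∈p∪q⁻)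
open import Data.Product using (_×_; _,_; proj₁; proj₂; ∃; Σ-syntax)
open import Data.Sum using (_⊎_; inj₁; inj₂)
open import Data.Vec using ([]; _∷_; _++_; concat; lookup; tabulate)
open import Data.Vec.Properties
  using (lookup∘tabulate; tabulate∘lookup; tabulate-cong; lookup-concat; []=⇒lookup; lookup⇒[]=)
open import Function using (_∘_)
open import Relation.Nullary using (¬_; does; yes; no; ¬?; contradiction)
open import Relation.Nullary.Decidable using (dec-true; dec-false; decidable-stable)
open import Relation.Binary.PropositionalEquality
  using (_≡_; _≢_; refl; sym; trans; cong; cong₂; subst; subst₂; module ≡-Reasoning)

private
  variable
    m n : ℕ

𝟙[_∈_] : Fin n → Subset n → ℕ
𝟙[ x ∈ p ] = if does (x ∈? p) then 1 else 0

𝟙-∈ : ∀ {x : Fin n} {p} → x ∈ p → 𝟙[ x ∈ p ] ≡ 1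
𝟙-∈ {x = x} {p} x∈p with x ∈? p
... | yes _   = refl
... | no  x∉p = contradiction x∈p x∉p

𝟙-mono : ∀ {x : Fin n} {p q} → p ⊆ q → 𝟙[ x ∈ p ] ≤ 𝟙[ x ∈ q ]
𝟙-mono {x = x} {p} {q} p⊆q with x ∈? p
... | yes x∈p = ≤-reflexive (sym (𝟙-∈ (p⊆q x∈p)))
... | no  _   = z≤n

∣p∣≡∑𝟙 : ∀ (p : Subset n) → ∣ p ∣ ≡ ∑[ x < n ] 𝟙[ x ∈ p ]
∣p∣≡∑𝟙 []            = refl
∣p∣≡∑𝟙 (inside  ∷ p) = cong suc (∣p∣≡∑𝟙 p)
∣p∣≡∑𝟙 (outside ∷ p) = ∣p∣≡∑𝟙 p

∑-mono-≤ : ∀ {f g : Fin n → ℕ} → (∀ i → f i ≤ g i) → ∑[ i < n ] f i ≤ ∑[ i < n ] g i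
∑-mono-≤ {n = zero}  f≤g = z≤n
∑-mono-≤ {n = suc n} f≤g = +-mono-≤ (f≤g zero) (∑-mono-≤ (f≤g ∘ suc))

∑-+𝟙 : ∀ (f : Fin n → ℕ) q → ∑[ x < n ] (f x + 𝟙[ x ∈ q ]) ≡ ∑[ x < n ] f x + ∣ q ∣
∑-+𝟙 f q = trans (∑-distrib-+ f (λ x → 𝟙[ x ∈ q ])) (cong (_ +_) (sym (∣p∣≡∑𝟙 q)))

∑-𝟙+𝟙* : ∀ (p q : Subset n) c → ∑[ x < n ] (𝟙[ x ∈ p ] + 𝟙[ x ∈ q ] * c) ≡ ∣ p ∣ + ∣ q ∣ * c
∑-𝟙+𝟙* {n} p q c = begin
  ∑[ x < n ] (𝟙[ x ∈ p ] + 𝟙[ x ∈ q ] * c)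
    ≡⟨ ∑-distrib-+ (λ x → 𝟙[ x ∈ p ]) (λ x → 𝟙[ x ∈ q ] * c) ⟩
  ∑[ x < n ] 𝟙[ x ∈ p ] + ∑[ x < n ] (𝟙[ x ∈ q ] * c)
    ≡⟨ cong (_ +_) (*-distribʳ-sum c (λ x → 𝟙[ x ∈ q ])) ⟨
  ∑[ x < n ] 𝟙[ x ∈ p ] + (∑[ x < n ] 𝟙[ x ∈ q ]) * c
    ≡⟨ cong₂ (λ a b → a + b * c) (∣p∣≡∑𝟙 p) (∣p∣≡∑𝟙 q) ⟨
  ∣ p ∣ + ∣ q ∣ * c ∎
  where open ≡-Reasoning

Subsingleton : Subset n → Set
Subsingleton p = ∀ {x y} → x ∈ p → y ∈ p → x ≡ y

Empty⇒∣p∣≡0 : ∀ {p : Subset n} → Empty p → ∣ p ∣ ≡ 0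
Empty⇒∣p∣≡0 {n} empty = trans (cong ∣_∣ (Empty-unique empty)) (∣⊥∣≡0 n)

Subsingleton⇒∣p∣≤1 : ∀ {p : Subset n} → Subsingleton p → ∣ p ∣ ≤ 1
Subsingleton⇒∣p∣≤1 {p = p} p≤1 with nonempty? p
... | yes (x , x∈p) = ≤-trans (p⊆q⇒∣p∣≤∣q∣ p⊆⁅x⁆) (≤-reflexive (∣⁅x⁆∣≡1 x))
  where
  p⊆⁅x⁆ : p ⊆ ⁅ x ⁆
  p⊆⁅x⁆ y∈p = subst (_∈ ⁅ x ⁆) (p≤1 x∈p y∈p) (x∈⁅x⁆ x)
... | no  empty = ≤-trans (≤-reflexive (Empty⇒∣p∣≡0 empty)) z≤n

⁅x⁆-subsingleton : ∀ (x : Fin n) → Subsingleton ⁅ x ⁆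
⁅x⁆-subsingleton x y∈ z∈ = trans (x∈⁅y⁆⇒x≡y x y∈) (sym (x∈⁅y⁆⇒x≡y x z∈))

∅-subsingleton : Subsingleton (∅ {n})
∅-subsingleton y∈ = contradiction y∈ ∉⊥

∈-tabulate⁺ : ∀ {f : Fin n → Bool} {x} → f x ≡ true → x ∈ tabulate f
∈-tabulate⁺ {f = f} {x} fx = lookup⇒[]= x _ (trans (lookup∘tabulate f x) fx)

∈-tabulate⁻ : ∀ {f : Fin n → Bool} {x} → x ∈ tabulate f → f x ≡ true
∈-tabulate⁻ {f = f} {x} x∈ = trans (sym (lookup∘tabulate f x)) ([]=⇒lookup x∈)

∣p++q∣ : ∀ (p : Subset m) (q : Subset n) → ∣ p ++ q ∣ ≡ ∣ p ∣ + ∣ q ∣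
∣p++q∣ []            q = refl
∣p++q∣ (inside  ∷ p) q = cong suc (∣p++q∣ p q)
∣p++q∣ (outside ∷ p) q = ∣p++q∣ p q

fromFibres : (Fin m → Subset n) → Subset (m * n)
fromFibres F = concat (tabulate F)

lookup-fromFibres : ∀ (F : Fin m → Subset n) g h → lookup (fromFibres F) (combine g h) ≡ lookup (F g) h
lookup-fromFibres F g h = trans (lookup-concat (tabulate F) g h) (cong (λ p → lookup p h) (lookup∘tabulate F g))

∈-fromFibres⁻ : ∀ (F : Fin m → Subset n) {g h} → combine g h ∈ fromFibres F → h ∈ F g
∈-fromFibres⁻ F {g} {h} x∈ = lookup⇒[]= h _ (trans (sym (lookup-fromFibres F g h)) ([]=⇒lookup x∈))

∣fromFibres∣ : ∀ (F : Fin m → Subset n) → ∣ fromFibres F ∣ ≡ ∑[ g < m ] ∣ F g ∣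
∣fromFibres∣ {zero}  F = refl
∣fromFibres∣ {suc m} F = trans (∣p++q∣ (F zero) _) (cong (∣ F zero ∣ +_) (∣fromFibres∣ (F ∘ suc)))

module Fibres {m n : ℕ} where

  fibre : Fin m → Subset (m * n) → Subset n
  fibre g X = tabulate (λ h → lookup X (combine g h))

  ∈-fibre⁻ : ∀ {X g h} → h ∈ fibre g X → combine g h ∈ X
  ∈-fibre⁻ {X} {g} {h} = lookup⇒[]= (combine g h) X ∘ ∈-tabulate⁻

  fromFibres-fibre : ∀ X → fromFibres (λ g → fibre g X) ≡ X
  fromFibres-fibre X = begin
    fromFibres fibres                   ≡⟨ tabulate∘lookup _ ⟨
    tabulate (lookup (fromFibres fibres)) ≡⟨ tabulate-cong pointwise ⟩
    tabulate (lookup X)                 ≡⟨ tabulate∘lookup X ⟩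
    X                                   ∎
    where
    open ≡-Reasoning
    fibres = λ g → fibre g X
    pointwise : ∀ x → lookup (fromFibres fibres) x ≡ lookup X x
    pointwise x = begin
      lookup (fromFibres fibres) x              ≡⟨ cong (lookup (fromFibres fibres)) (combine-remQuot {m} n x) ⟨
      lookup (fromFibres fibres) (combine g h)  ≡⟨ lookup-fromFibres fibres g h ⟩
      lookup (fibre g X) h                      ≡⟨ lookup∘tabulate _ h ⟩
      lookup X (combine g h)                    ≡⟨ cong (lookup X) (combine-remQuot {m} n x) ⟩
      lookup X x                                ∎
      where
      g = quotient n x
      h = remainder {m} n x

  ∣X∣≡∑∣fibre∣ : ∀ X → ∣ X ∣ ≡ ∑[ g < m ] ∣ fibre g X ∣
  ∣X∣≡∑∣fibre∣ X = trans (cong ∣_∣ (sym (fromFibres-fibre X))) (∣fromFibres∣ (λ g → fibre g X))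

ClosedNbhdsDisjoint : Graph n → Fin n → Fin n → Set
ClosedNbhdsDisjoint G u v = ∀ w → ¬ (InClosedNbhd G u w × InClosedNbhd G v w)

IsIsolatedSet : Graph n → Subset n → Set
IsIsolatedSet G I = ∀ u → (u ∈ I → Isolated G u) × (Isolated G u → u ∈ I)

module _ (G : Graph n) where

  ¬Isolated⇒adjacent : ∀ {u} → ¬ Isolated G u → ∃ (Adj G u)
  ¬Isolated⇒adjacent {u} ¬iso with ¬∀⟶∃¬ n (λ v → ¬ Adj G u v) (λ v → ¬? (dec G u v)) ¬iso
  ... | v , ¬¬uv = v , decidable-stable (dec G u v) ¬¬uv

  disjoint-sym : ∀ {u v} → ClosedNbhdsDisjoint G u v → ClosedNbhdsDisjoint G v u
  disjoint-sym disj w (wv , wu) = disj w (wu , wv)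

  isolated-disjoint : ∀ {u v} → Isolated G u → u ≢ v → ClosedNbhdsDisjoint G u v
  isolated-disjoint iso u≢v w (inj₂ uw , _)          = iso w uw
  isolated-disjoint iso u≢v w (inj₁ refl , inj₁ w≡v) = u≢v w≡v
  isolated-disjoint iso u≢v w (inj₁ refl , inj₂ vu)  = iso _ (Graph.sym G vu)

  subsingleton-packing : ∀ {P} → Subsingleton P → IsPacking G P
  subsingleton-packing P≤1 u v u∈P v∈P u≢v = contradiction (P≤1 u∈P v∈P) u≢v

  module _ {I} (isolated : IsIsolatedSet G I) where

    ∈isolated⇒Isolated : ∀ {u} → u ∈ I → Isolated G u
    ∈isolated⇒Isolated {u} = proj₁ (isolated u)

    ∉isolated⇒adjacent : ∀ {u} → u ∉ I → ∃ (Adj G u)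
    ∉isolated⇒adjacent {u} u∉I = ¬Isolated⇒adjacent (u∉I ∘ proj₂ (isolated u))

    adjacent⇒∉isolated : ∀ {u v} → Adj G u v → u ∉ I
    adjacent⇒∉isolated uv u∈I = ∈isolated⇒Isolated u∈I _ uv

  packing-∪-isolated : ∀ {P J} → IsPacking G P → (∀ {u} → u ∈ J → Isolated G u) → IsPacking G (P ∪ J)
  packing-∪-isolated {P} {J} P-packing J-isolated u v u∈ v∈ u≢v
    with x∈p∪q⁻ P J u∈ | x∈p∪q⁻ P J v∈
  ... | inj₂ u∈J | _        = isolated-disjoint (J-isolated u∈J) u≢v
  ... | inj₁ _   | inj₂ v∈J = disjoint-sym (isolated-disjoint (J-isolated v∈J) (u≢v ∘ sym))
  ... | inj₁ u∈P | inj₁ v∈P = P-packing u v u∈P v∈P u≢v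

module Lex {m n} (G : Graph m) (H : Graph n) where
  open Fibres {m} {n}

  G∘H : Graph (m * n)
  G∘H = lex G H

  quotient-combine : ∀ g (h : Fin n) → quotient {m} n (combine g h) ≡ g
  quotient-combine g h = cong proj₁ (remQuot-combine g h)

  remainder-combine : ∀ (g : Fin m) h → remainder {m} n (combine g h) ≡ h
  remainder-combine g h = cong proj₂ (remQuot-combine g h)

  adjacentˡ : ∀ {g g' : Fin m} {h h' : Fin n} → Adj G g g' → Adj G∘H (combine g h) (combine g' h')
  adjacentˡ {g} {g'} {h} {h'} gg' =
    inj₁ (subst₂ (Adj G) (sym (quotient-combine g h)) (sym (quotient-combine g' h')) gg')

  nbhdʳ : ∀ {g : Fin m} {h h' : Fin n} → InClosedNbhd H h h' → InClosedNbhd G∘H (combine g h) (combine g h')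
  nbhdʳ (inj₁ refl) = inj₁ refl
  nbhdʳ {g} {h} {h'} (inj₂ hh') = inj₂ (inj₂
    ( trans (quotient-combine g h) (sym (quotient-combine g h'))
    , subst₂ (Adj H) (sym (remainder-combine g h)) (sym (remainder-combine g h')) hh'))

  nbhd-quotient : ∀ {g : Fin m} {h : Fin n} {w} → InClosedNbhd G∘H (combine g h) w → InClosedNbhd G g (quotient n w)
  nbhd-quotient {g} {h} (inj₁ refl)              = inj₁ (quotient-combine g h)
  nbhd-quotient {g} {h} (inj₂ (inj₁ gw))         = inj₂ (subst (λ u → Adj G u _) (quotient-combine g h) gw)
  nbhd-quotient {g} {h} (inj₂ (inj₂ (g≡w , _))) = inj₁ (trans (sym g≡w) (quotient-combine g h))

  nbhd-split : ∀ {g : Fin m} {h : Fin n} {w} → InClosedNbhd G∘H (combine g h) w →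
               Adj G g (quotient n w) ⊎ InClosedNbhd H h (remainder {m} n w)
  nbhd-split {g} {h} (inj₁ refl)            = inj₂ (inj₁ (remainder-combine g h))
  nbhd-split {g} {h} (inj₂ (inj₁ gw))       = inj₁ (subst (λ u → Adj G u _) (quotient-combine g h) gw)
  nbhd-split {g} {h} (inj₂ (inj₂ (_ , hw))) = inj₂ (inj₂ (subst (λ u → Adj H u _) (remainder-combine g h) hw))

  packing-by-coordinates : ∀ {X} →
    (∀ {g g' : Fin m} {h h' : Fin n} → combine g h ∈ X → combine g' h' ∈ X → combine g h ≢ combine g' h' →
       ClosedNbhdsDisjoint G∘H (combine g h) (combine g' h')) →
    IsPacking G∘H X
  packing-by-coordinates {X} disjoint x y x∈X y∈X x≢y =
    subst₂ (ClosedNbhdsDisjoint G∘H) (combine-remQuot {m} n x) (combine-remQuot {m} n y)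
      (disjoint (subst (_∈ X) (sym (combine-remQuot {m} n x)) x∈X)
                (subst (_∈ X) (sym (combine-remQuot {m} n y)) y∈X)
                (x≢y ∘ subst₂ _≡_ (combine-remQuot {m} n x) (combine-remQuot {m} n y)))

  fromFibres-packing : ∀ {S} {F : Fin m → Subset n} → IsPacking G S → (∀ {g h} → h ∈ F g → g ∈ S) →
    (∀ g → IsPacking H (F g)) → (∀ {g v} → Adj G g v → Subsingleton (F g)) →
    IsPacking G∘H (fromFibres F)
  fromFibres-packing {S} {F} S-packing F⊆S F-packing F-subsingleton =
    packing-by-coordinates (λ x∈ y∈ → disjoint (∈-fromFibres⁻ F x∈) (∈-fromFibres⁻ F y∈))
    where
    disjoint : ∀ {g g' : Fin m} {h h' : Fin n} → h ∈ F g → h' ∈ F g' →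
               combine g h ≢ combine g' h' → ClosedNbhdsDisjoint G∘H (combine g h) (combine g' h')
    disjoint {g} {g'} h∈ h'∈ x≢y w (wx , wy) with g ≟ g'
    ... | no g≢g' = S-packing g g' (F⊆S h∈) (F⊆S h'∈) g≢g' (quotient n w) (nbhd-quotient wx , nbhd-quotient wy)
    ... | yes refl with nbhd-split wx | nbhd-split wy
    ... | inj₁ gw | _        = x≢y (cong (combine g) (F-subsingleton gw h∈ h'∈))
    ... | inj₂ _  | inj₁ gw  = x≢y (cong (combine g) (F-subsingleton gw h∈ h'∈))
    ... | inj₂ hw | inj₂ h'w = F-packing g _ _ h∈ h'∈ (x≢y ∘ cong (combine g)) (remainder {m} n w) (hw , h'w)

  meeting-nbhds-lift : ∀ {u v w} {h h' : Fin n} → u ≢ v → InClosedNbhd G u w → InClosedNbhd G v w →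
    ∃ λ z → InClosedNbhd G∘H (combine u h) z × InClosedNbhd G∘H (combine v h') z
  meeting-nbhds-lift u≢v (inj₁ w≡u) (inj₁ w≡v) = contradiction (trans (sym w≡u) w≡v) u≢v
  meeting-nbhds-lift u≢v (inj₁ refl) (inj₂ vu) = _ , inj₁ refl , inj₂ (adjacentˡ vu)
  meeting-nbhds-lift u≢v (inj₂ uv) (inj₁ refl) = _ , inj₂ (adjacentˡ uv) , inj₁ refl
  meeting-nbhds-lift {w = w} {h} u≢v (inj₂ uw) (inj₂ vw) =
    combine w h , inj₂ (adjacentˡ uw) , inj₂ (adjacentˡ vw)

  support : Subset (m * n) → Subset m
  support X = tabulate (λ g → does (nonempty? (fibre g X)))

  ∈-support⁺ : ∀ {X g} → Nonempty (fibre g X) → g ∈ support X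
  ∈-support⁺ {X} {g} nonempty = ∈-tabulate⁺ (dec-true (nonempty? (fibre g X)) nonempty)

  ∈-support⁻ : ∀ {X g} → g ∈ support X → Nonempty (fibre g X)
  ∈-support⁻ {X} {g} g∈ = decidable-stable (nonempty? (fibre g X)) λ empty →
    contradiction (trans (sym (∈-tabulate⁻ g∈)) (dec-false (nonempty? (fibre g X)) empty)) λ ()

  module _ {X} (X-packing : IsPacking G∘H X) where

    fibre-packing : ∀ g → IsPacking H (fibre g X)
    fibre-packing g u v u∈ v∈ u≢v w (wu , wv) =
      X-packing _ _ (∈-fibre⁻ {X} u∈) (∈-fibre⁻ {X} v∈) (u≢v ∘ combine-injectiveʳ g u g v)
        (combine g w) (nbhdʳ wu , nbhdʳ wv)

    fibre-subsingleton : ∀ {g v} → Adj G g v → Subsingleton (fibre g X)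
    fibre-subsingleton {g} {v} gv {h} {h'} h∈ h'∈ with h ≟ h'
    ... | yes h≡h' = h≡h'
    ... | no  h≢h' = contradiction (inj₂ (adjacentˡ gv) , inj₂ (adjacentˡ gv))
                       (X-packing _ _ (∈-fibre⁻ {X} h∈) (∈-fibre⁻ {X} h'∈) (h≢h' ∘ combine-injectiveʳ g h g h')
                         (combine v h))

    support-packing : IsPacking G (support X)
    support-packing u v u∈ v∈ u≢v w (wu , wv)
      with h , h∈ ← ∈-support⁻ {X} u∈ | h' , h'∈ ← ∈-support⁻ {X} v∈
      with z , zx , zy ← meeting-nbhds-lift {h = h} {h'} u≢v wu wv
      = X-packing _ _ (∈-fibre⁻ {X} h∈) (∈-fibre⁻ {X} h'∈) (u≢v ∘ combine-injectiveˡ u h v h') z (zx , zy)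

  ∣fibre∣≤𝟙[∈support] : ∀ {X g} → Subsingleton (fibre g X) → ∣ fibre g X ∣ ≤ 𝟙[ g ∈ support X ]
  ∣fibre∣≤𝟙[∈support] {X} {g} fibre≤1 with g ∈? support X
  ... | yes _  = Subsingleton⇒∣p∣≤1 fibre≤1
  ... | no  g∉ = ≤-reflexive (Empty⇒∣p∣≡0 (g∉ ∘ ∈-support⁺ {X}))

  module _ {I} (isolated : IsIsolatedSet G I) where

    fibre-bound : ∀ {X ρH} → IsPacking G∘H X → (∀ R → IsPacking H R → ∣ R ∣ ≤ ρH) → ∀ g →
      ∣ fibre g X ∣ + 𝟙[ g ∈ I ] ≤ 𝟙[ g ∈ support X ∪ I ] + 𝟙[ g ∈ I ] * ρH
    fibre-bound {X} {ρH} X-packing H-max g with g ∈? I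
    ... | yes g∈I rewrite 𝟙-∈ (x∈p∪q⁺ {p = support X} (inj₂ g∈I)) | *-identityˡ ρH
                        | +-comm ∣ fibre g X ∣ 1 =
      s≤s (H-max _ (fibre-packing X-packing g))
    ... | no  g∉I =
      +-monoˡ-≤ 0 (≤-trans (∣fibre∣≤𝟙[∈support] {X} {g} fibre≤1) (𝟙-mono {x = g} {p = support X} (p⊆p∪q I)))
      where
      fibre≤1 : Subsingleton (fibre g X)
      fibre≤1 = fibre-subsingleton X-packing (proj₂ (∉isolated⇒adjacent G isolated g∉I))

    upper-bound : ∀ {P ρH} → IsPacking G∘H P → (∀ R → IsPacking H R → ∣ R ∣ ≤ ρH) →
      ∣ P ∣ + ∣ I ∣ ≤ ∣ support P ∪ I ∣ + ∣ I ∣ * ρH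
    upper-bound {P} {ρH} P-packing H-max = begin
      ∣ P ∣ + ∣ I ∣                                          ≡⟨ cong (_+ ∣ I ∣) (∣X∣≡∑∣fibre∣ P) ⟩
      ∑[ g < m ] ∣ fibre g P ∣ + ∣ I ∣                        ≡⟨ ∑-+𝟙 (λ g → ∣ fibre g P ∣) I ⟨
      ∑[ g < m ] (∣ fibre g P ∣ + 𝟙[ g ∈ I ])                ≤⟨ ∑-mono-≤ (fibre-bound P-packing H-max) ⟩
      ∑[ g < m ] (𝟙[ g ∈ support P ∪ I ] + 𝟙[ g ∈ I ] * ρH) ≡⟨ ∑-𝟙+𝟙* (support P ∪ I) I ρH ⟩
      ∣ support P ∪ I ∣ + ∣ I ∣ * ρH                          ∎
      where open ≤-Reasoning

    module _ (h₀ : Fin n) (Q : Subset m) (R : Subset n) where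

      liftedFibre : Fin m → Subset n
      liftedFibre g with g ∈? I | g ∈? Q
      ... | yes _ | _     = R
      ... | no  _ | yes _ = ⁅ h₀ ⁆
      ... | no  _ | no  _ = ∅

      liftedFibre-subsingleton : ∀ {g} → g ∉ I → Subsingleton (liftedFibre g)
      liftedFibre-subsingleton {g} g∉I with g ∈? I | g ∈? Q
      ... | yes g∈I | _     = contradiction g∈I g∉I
      ... | no  _   | yes _ = ⁅x⁆-subsingleton h₀
      ... | no  _   | no  _ = ∅-subsingleton

      liftedFibre-packing : IsPacking H R → ∀ g → IsPacking H (liftedFibre g)
      liftedFibre-packing R-packing g with g ∈? I | g ∈? Q
      ... | yes _ | _     = R-packing
      ... | no  _ | yes _ = subsingleton-packing H (⁅x⁆-subsingleton h₀)
      ... | no  _ | no  _ = subsingleton-packing H ∅-subsingleton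

      liftedFibre-support : ∀ {g h} → h ∈ liftedFibre g → g ∈ Q ∪ I
      liftedFibre-support {g} h∈ with g ∈? I | g ∈? Q
      ... | yes g∈I | _     = x∈p∪q⁺ (inj₂ g∈I)
      ... | no  _   | yes g∈Q = x∈p∪q⁺ (inj₁ g∈Q)
      ... | no  _   | no  _ = contradiction h∈ ∉⊥

      liftedFibre-bound : ∀ g → 𝟙[ g ∈ Q ] + 𝟙[ g ∈ I ] * ∣ R ∣ ≤ ∣ liftedFibre g ∣ + 𝟙[ g ∈ I ]
      liftedFibre-bound g with g ∈? I | g ∈? Q
      ... | yes _ | yes _ rewrite *-identityˡ ∣ R ∣ = ≤-reflexive (+-comm 1 ∣ R ∣)
      ... | yes _ | no  _ rewrite *-identityˡ ∣ R ∣ = m≤m+n ∣ R ∣ 1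
      ... | no  _ | yes _ = ≤-reflexive (cong (_+ 0) (sym (∣⁅x⁆∣≡1 h₀)))
      ... | no  _ | no  _ = z≤n

      lower-bound : IsPacking G Q → IsPacking H R →
        Σ[ X ∈ Subset (m * n) ] IsPacking G∘H X × ∣ Q ∣ + ∣ I ∣ * ∣ R ∣ ≤ ∣ X ∣ + ∣ I ∣
      lower-bound Q-packing R-packing = fromFibres liftedFibre , X-packing , size
        where
        X-packing : IsPacking G∘H (fromFibres liftedFibre)
        X-packing = fromFibres-packing
          (packing-∪-isolated G Q-packing (∈isolated⇒Isolated G isolated))
          liftedFibre-support
          (liftedFibre-packing R-packing)
          (liftedFibre-subsingleton ∘ adjacent⇒∉isolated G isolated)
        size : ∣ Q ∣ + ∣ I ∣ * ∣ R ∣ ≤ ∣ fromFibres liftedFibre ∣ + ∣ I ∣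
        size = begin
          ∣ Q ∣ + ∣ I ∣ * ∣ R ∣                              ≡⟨ ∑-𝟙+𝟙* Q I ∣ R ∣ ⟨
          ∑[ g < m ] (𝟙[ g ∈ Q ] + 𝟙[ g ∈ I ] * ∣ R ∣)      ≤⟨ ∑-mono-≤ liftedFibre-bound ⟩
          ∑[ g < m ] (∣ liftedFibre g ∣ + 𝟙[ g ∈ I ])        ≡⟨ ∑-+𝟙 (λ g → ∣ liftedFibre g ∣) I ⟩
          ∑[ g < m ] ∣ liftedFibre g ∣ + ∣ I ∣               ≡⟨ cong (_+ ∣ I ∣) (∣fromFibres∣ liftedFibre) ⟨
          ∣ fromFibres liftedFibre ∣ + ∣ I ∣                 ∎
          where open ≤-Reasoning

theorem6 : ∀ {m n} (G : Graph (suc m)) (H : Graph (suc n)) (ρG ρH ρGH iG : ℕ) →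
    PackingNumber G ρG → PackingNumber H ρH → PackingNumber (lex G H) ρGH →
    IsolatedCount G iG →
    ρGH + iG ≡ ρG + iG * ρH
theorem6 G H _ _ _ _ ((Q , Q-packing , refl) , G-max) ((R , R-packing , refl) , H-max)
         ((P , P-packing , refl) , G∘H-max) (I , isolated , refl)
  with X , X-packing , ∣Q∣+∣I∣∣R∣≤∣X∣+∣I∣ ← Lex.lower-bound G H isolated zero Q R Q-packing R-packing
  = ≤-antisym (≤-trans (upper-bound isolated P-packing H-max) (+-monoˡ-≤ _ (G-max _ S-packing)))
              (≤-trans ∣Q∣+∣I∣∣R∣≤∣X∣+∣I∣ (+-monoˡ-≤ _ (G∘H-max X X-packing)))
  where
  open Lex G H
  S-packing : IsPacking G (support P ∪ I)
  S-packing = packing-∪-isolated G (support-packing P-packing) (∈isolated⇒Isolated G isolated)
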